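{- Let $X$ be any mincut of $G$ (with $r\notin X$). Then there is a set of vertices $S\subseteq V$ such that all vertices of $S$ have the same parent in $\hat T$ and $X=\bigcup_{u\in S}\hat T_u$.
   Context: $G=(V,E,w)$ is an undirected graph with nonnegative weights and fixed root $r$. Cuts are identified with the side $X$ not containing $r$; a mincut is a cut of minimum weight. The minimal mincut $X_v$ of $v\neq r$ is the least-size mincut containing $v$; set $X_r=V$. Assume every non-root vertex has a minimal mincut and these minimal mincuts are pairwise distinct. The nesting relation tree $\hat T$ has vertex set $V$, root $r$, and the parent of $v\neq r$ is the unique vertex $p_v$ with $X_v\subsetneq X_{p_v}$ such that no vertex $u$ satisfies $X_v\subsetneq X_u\subsetneq X_{p_v}$. $\hat T_v$ denotes the set of vertices in the subtree of $\hat T$ rooted at $v$.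
   Formalization: The edge weights of $G$ are nonnegative rationals. -}

module Defs where

open import Data.Nat using (ℕ; zero; suc)
import Data.Nat as ℕ
open import Data.Fin using (Fin; zero; suc)
open import Data.Bool using (Bool; true; false; if_then_else_; _∧_; not)
open import Data.Vec using (lookup)
open import Data.Rational using (ℚ; 0ℚ; _+_; _≤_)
open import Data.Fin.Subset using (Subset; _∈_; _∉_; _⊂_; Nonempty; ∣_∣; ⊤)
open import Data.Product using (Σ; ∃; _×_; _,_)
open import Relation.Nullary using (¬_)
open import Relation.Binary.PropositionalEquality using (_≡_; _≢_)
open import Relation.Binary.Construct.Closure.ReflexiveTransitive using (Star)

sumFin : ∀ {n} → (Fin n → ℚ) → ℚ
sumFin {zero}  f = 0ℚ
sumFin {suc n} f = f zero + sumFin (λ i → f (suc i))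

record WGraph (n : ℕ) : Set where
  field
    w      : Fin n → Fin n → ℚ
    w-sym  : ∀ i j → w i j ≡ w j i
    w-nonneg : ∀ i j → 0ℚ ≤ w i j

open WGraph public

cutWeight : ∀ {n} → WGraph n → Subset n → ℚ
cutWeight G X = sumFin λ i → sumFin λ j →
  if lookup X i ∧ not (lookup X j) then w G i j else 0ℚ

IsCut : ∀ {n} → Fin n → Subset n → Set
IsCut r X = Nonempty X × r ∉ X

IsMincut : ∀ {n} → WGraph n → Fin n → Subset n → Set
IsMincut G r X = IsCut r X × (∀ Y → IsCut r Y → cutWeight G X ≤ cutWeight G Y)

IsMinimalMincut : ∀ {n} → WGraph n → Fin n → Fin n → Subset n → Set
IsMinimalMincut G r v X =
  IsMincut G r X × v ∈ X × (∀ Y → IsMincut G r Y → v ∈ Y → ∣ X ∣ ℕ.≤ ∣ Y ∣)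

record MinimalMincuts {n} (G : WGraph n) (r : Fin n) : Set where
  field
    Xm        : Fin n → Subset n
    Xm-root   : Xm r ≡ ⊤
    Xm-min    : ∀ v → v ≢ r → IsMinimalMincut G r v (Xm v)
    Xm-distinct : ∀ u v → u ≢ r → v ≢ r → u ≢ v → Xm u ≢ Xm v

open MinimalMincuts public

module _ {n} {G : WGraph n} {r : Fin n} (M : MinimalMincuts G r) where

  -- p is the parent of v in the nesting relation tree T̂.
  IsParent : Fin n → Fin n → Set
  IsParent p v = v ≢ r × Xm M v ⊂ Xm M p
    × (¬ ∃ λ u → Xm M v ⊂ Xm M u × Xm M u ⊂ Xm M p)

  -- x ∈ T̂_u : x lies in the subtree of T̂ rooted at u (a downward parent-chain from u to x).
  InSubtree : Fin n → Fin n → Set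
  InSubtree u x = Star IsParent u x

{-# OPTIONS --safe #-}

-- Cut weight is submodular and posimodular, so two crossing mincuts can be
-- uncrossed into mincuts X ∩ Y and X ∖ Y.  Minimality of X_v then forces: a
-- mincut containing v contains X_v, and a mincut meeting X_v but avoiding v lies
-- inside X_v.  Hence the minimal mincuts form a laminar family, and the parent of
-- a vertex u is any vertex whose minimal mincut is a smallest one strictly above
-- X_u.  Given a mincut X, take S to be the vertices u with X_u maximal among the
-- minimal mincuts inside X, and p a vertex with X_p a smallest minimal mincut
-- strictly above X.  Every u ∈ S has parent p, since a minimal mincut strictly
-- between X_u and X_p would either lie inside X or strictly contain X.  Every
-- x ∈ X has X_x ⊆ X, and climbing parents from x stays inside X until it reaches S.

module Submission where

open import Defs
open import Algebra.Bundles using (CommutativeMonoid)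
open import Data.Bool.Base
  using (Bool; true; false; if_then_else_; _∧_; _∨_; not; b≤b; f≤t) renaming (_≤_ to _≤ᵇ_)
open import Data.Bool.Properties
  using (≤-minimum; ≤-maximum; T-≡; not-involutive; ∧-comm)
open import Data.Empty using (⊥-elim)
open import Data.Fin.Base using (Fin; zero; suc)
open import Data.Fin.Properties using (_≟_; any?)
open import Data.Fin.Subset using (Subset; _∈_; _∉_; _⊆_; _⊂_; ∣_∣; _∩_; _∪_; ∁)
open import Data.Fin.Subset.Properties
  using ( _∈?_; _⊆?_; _⊂?_; ∈⊤; ⊆-refl; ⊆-trans; ⊆-⊂-trans; p⊂q⇒p⊆q; p⊂q⇒∣p∣<∣q∣; ∣p∣≤n
        ; p∩q⊆p; p∩q⊆q; x∈p∩q⁺; x∈p∪q⁺; x∈p∪q⁻; x∈∁p⇒x∉p; x∉p⇒x∈∁p)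
open import Data.Nat.Base as ℕ using (ℕ; _∸_)
open import Data.Nat.Induction using (<-wellFounded)
open import Data.Nat.Properties using (_<?_; <⇒≱; ≮⇒≥; ∸-monoʳ-<)
open import Data.Product using (Σ; ∃; _×_; _,_; proj₁; proj₂)
open import Data.Rational.Base using (ℚ; 0ℚ; _+_; -_; _≤_)
open import Data.Rational.Properties
  using ( ≤-refl; ≤-trans; ≤-reflexive; +-mono-≤; +-monoˡ-≤; +-monoʳ-≤; +-comm; +-assoc
        ; +-identityˡ; +-identityʳ; +-inverseʳ; +-0-commutativeMonoid; module ≤-Reasoning)
open import Data.Sum using (_⊎_; inj₁; inj₂; [_,_])
open import Data.Vec.Base using (lookup; tabulate)
open import Data.Vec.Properties
  using (lookup-zipWith; lookup-map; lookup∘tabulate; []=⇒lookup; lookup⇒[]=)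
open import Function using (_∘_)
open import Function.Bundles using (_⇔_; mk⇔; Equivalence)
open import Induction.WellFounded using (Acc; acc)
open import Relation.Binary.PropositionalEquality
  using (_≡_; _≢_; refl; sym; trans; cong; cong₂; subst₂)
open import Relation.Binary.Construct.Closure.ReflexiveTransitive using (ε; _◅_; _◅◅_)
open import Relation.Nullary using (¬_; yes; no)
open import Relation.Nullary.Decidable using (isYes; _×-dec_; ¬?; toWitness; fromWitness)
open import Relation.Unary using (Pred; Decidable)

open import Algebra.Properties.CommutativeSemigroup
  (CommutativeMonoid.commutativeSemigroup +-0-commutativeMonoid) using (interchange)


sumFin-cong : ∀ {n} {f g : Fin n → ℚ} → (∀ i → f i ≡ g i) → sumFin f ≡ sumFin g
sumFin-cong {ℕ.zero}  f≡g = refl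
sumFin-cong {ℕ.suc n} f≡g = cong₂ _+_ (f≡g zero) (sumFin-cong (f≡g ∘ suc))

sumFin-mono : ∀ {n} {f g : Fin n → ℚ} → (∀ i → f i ≤ g i) → sumFin f ≤ sumFin g
sumFin-mono {ℕ.zero}  f≤g = ≤-refl
sumFin-mono {ℕ.suc n} f≤g = +-mono-≤ (f≤g zero) (sumFin-mono (f≤g ∘ suc))

sumFin-+ : ∀ {n} (f g : Fin n → ℚ) → sumFin (λ i → f i + g i) ≡ sumFin f + sumFin g
sumFin-+ {ℕ.zero}  f g = refl
sumFin-+ {ℕ.suc n} f g =
  trans (cong (f zero + g zero +_) (sumFin-+ (f ∘ suc) (g ∘ suc)))
        (interchange (f zero) (g zero) (sumFin (f ∘ suc)) (sumFin (g ∘ suc)))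

sumFin-zero : ∀ {n} → sumFin {n} (λ _ → 0ℚ) ≡ 0ℚ
sumFin-zero {ℕ.zero}  = refl
sumFin-zero {ℕ.suc n} = trans (+-identityˡ _) (sumFin-zero {n})

sumFin-swap : ∀ {m k} (f : Fin m → Fin k → ℚ) →
              sumFin (λ i → sumFin (f i)) ≡ sumFin (λ j → sumFin (λ i → f i j))
sumFin-swap {ℕ.zero} {k} f = sym (sumFin-zero {k})
sumFin-swap {ℕ.suc m} f =
  trans (cong (sumFin (f zero) +_) (sumFin-swap (f ∘ suc))) (sym (sumFin-+ (f zero) _))

+-cancelʳ-≤ : ∀ c {a b} → a + c ≤ b + c → a ≤ b
+-cancelʳ-≤ c {a} {b} a+c≤b+c = begin
  a                ≡⟨ sym (+-identityʳ a) ⟩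
  a + 0ℚ           ≡⟨ cong (a +_) (sym (+-inverseʳ c)) ⟩
  a + (c + - c)    ≡⟨ sym (+-assoc a c (- c)) ⟩
  (a + c) + - c    ≤⟨ +-monoˡ-≤ (- c) a+c≤b+c ⟩
  (b + c) + - c    ≡⟨ +-assoc b c (- c) ⟩
  b + (c + - c)    ≡⟨ cong (b +_) (+-inverseʳ c) ⟩
  b + 0ℚ           ≡⟨ +-identityʳ b ⟩
  b                ∎
  where open ≤-Reasoning

indicator : Bool → ℚ → ℚ
indicator b x = if b then x else 0ℚ

indicator-mono : ∀ {a b x} → 0ℚ ≤ x → a ≤ᵇ b → indicator a x ≤ indicator b x
indicator-mono 0≤x b≤b = ≤-refl
indicator-mono 0≤x f≤t = 0≤x

Dominated : Bool → Bool → Bool → Bool → Set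
Dominated l₁ l₂ r₁ r₂ = (l₁ ≤ᵇ r₁ × l₂ ≤ᵇ r₂) ⊎ (l₁ ≤ᵇ r₂ × l₂ ≤ᵇ r₁)

indicator-+-mono : ∀ {l₁ l₂ r₁ r₂ x} → 0ℚ ≤ x → Dominated l₁ l₂ r₁ r₂ →
                   indicator l₁ x + indicator l₂ x ≤ indicator r₁ x + indicator r₂ x
indicator-+-mono 0≤x (inj₁ (l₁≤r₁ , l₂≤r₂)) =
  +-mono-≤ (indicator-mono 0≤x l₁≤r₁) (indicator-mono 0≤x l₂≤r₂)
indicator-+-mono {l₁} {l₂} {x = x} 0≤x (inj₂ (l₁≤r₂ , l₂≤r₁)) =
  ≤-trans (≤-reflexive (+-comm (indicator l₁ x) (indicator l₂ x)))
          (+-mono-≤ (indicator-mono 0≤x l₂≤r₁) (indicator-mono 0≤x l₁≤r₂))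

-- a, b record whether the tail i of an edge lies in A, B, and c, d whether its head j does.
cut-submodularᵇ : ∀ a b c d →
  Dominated ((a ∧ b) ∧ not (c ∧ d)) ((a ∨ b) ∧ not (c ∨ d)) (a ∧ not c) (b ∧ not d)
cut-submodularᵇ false false c     d = inj₁ (≤-minimum _ , ≤-minimum _)
cut-submodularᵇ true  false true  d = inj₂ (b≤b , b≤b)
cut-submodularᵇ true  false false d = inj₂ (b≤b , ≤-maximum _)
cut-submodularᵇ false true  true  d = inj₁ (b≤b , ≤-minimum _)
cut-submodularᵇ false true  false d = inj₁ (b≤b , b≤b)
cut-submodularᵇ true  true  true  d = inj₂ (b≤b , b≤b)
cut-submodularᵇ true  true  false d = inj₁ (b≤b , b≤b)

module _ {n} (G : WGraph n) where

  cutWeightᶠ : (Fin n → Bool) → ℚ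
  cutWeightᶠ f = sumFin λ i → sumFin λ j → indicator (f i ∧ not (f j)) (w G i j)

  cutWeightᶠ-cong : ∀ {f g} → (∀ i → f i ≡ g i) → cutWeightᶠ f ≡ cutWeightᶠ g
  cutWeightᶠ-cong f≡g = sumFin-cong λ i → sumFin-cong λ j →
    cong₂ (λ a b → indicator (a ∧ not b) (w G i j)) (f≡g i) (f≡g j)

  cutWeightᶠ-∁ : ∀ f → cutWeightᶠ (not ∘ f) ≡ cutWeightᶠ f
  cutWeightᶠ-∁ f = trans
    (sumFin-cong λ i → sumFin-cong λ j →
      cong₂ indicator (not-not-∧ (f i) (f j)) (w-sym G i j))
    (sumFin-swap λ i j → indicator (f j ∧ not (f i)) (w G j i))
    where
    not-not-∧ : ∀ a c → not a ∧ not (not c) ≡ c ∧ not a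
    not-not-∧ a c = trans (cong (not a ∧_) (not-involutive c)) (∧-comm (not a) c)

  cutWeightᶠ-submodular : ∀ f g →
    cutWeightᶠ (λ i → f i ∧ g i) + cutWeightᶠ (λ i → f i ∨ g i) ≤ cutWeightᶠ f + cutWeightᶠ g
  cutWeightᶠ-submodular f g =
    subst₂ _≤_ (sumFin²-+ (cut (λ i → f i ∧ g i)) (cut (λ i → f i ∨ g i))) (sumFin²-+ (cut f) (cut g))
    (sumFin-mono λ i → sumFin-mono λ j →
      indicator-+-mono (w-nonneg G i j) (cut-submodularᵇ (f i) (g i) (f j) (g j)))
    where
    cut : (Fin n → Bool) → Fin n → Fin n → ℚ
    cut h i j = indicator (h i ∧ not (h j)) (w G i j)
    sumFin²-+ : ∀ (u v : Fin n → Fin n → ℚ) →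
      sumFin (λ i → sumFin (λ j → u i j + v i j))
        ≡ sumFin (λ i → sumFin (u i)) + sumFin (λ i → sumFin (v i))
    sumFin²-+ u v = trans (sumFin-cong λ i → sumFin-+ (u i) (v i))
                          (sumFin-+ (λ i → sumFin (u i)) (λ i → sumFin (v i)))

  cutWeightᶠ-posimodular : ∀ f g →
    cutWeightᶠ (λ i → f i ∧ not (g i)) + cutWeightᶠ (λ i → g i ∧ not (f i))
      ≤ cutWeightᶠ f + cutWeightᶠ g
  cutWeightᶠ-posimodular f g = begin
    cutWeightᶠ (λ i → f i ∧ not (g i)) + cutWeightᶠ (λ i → g i ∧ not (f i))
      ≡⟨ cong (cutWeightᶠ (λ i → f i ∧ not (g i)) +_) g∖f≡f∪∁g ⟩
    cutWeightᶠ (λ i → f i ∧ not (g i)) + cutWeightᶠ (λ i → f i ∨ not (g i))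
      ≤⟨ cutWeightᶠ-submodular f (not ∘ g) ⟩
    cutWeightᶠ f + cutWeightᶠ (not ∘ g)
      ≡⟨ cong (cutWeightᶠ f +_) (cutWeightᶠ-∁ g) ⟩
    cutWeightᶠ f + cutWeightᶠ g ∎
    where
    open ≤-Reasoning
    not-∧-not : ∀ a b → not (b ∧ not a) ≡ a ∨ not b
    not-∧-not false false = refl
    not-∧-not false true  = refl
    not-∧-not true  false = refl
    not-∧-not true  true  = refl
    g∖f≡f∪∁g : cutWeightᶠ (λ i → g i ∧ not (f i)) ≡ cutWeightᶠ (λ i → f i ∨ not (g i))
    g∖f≡f∪∁g = trans (sym (cutWeightᶠ-∁ λ i → g i ∧ not (f i)))
                     (cutWeightᶠ-cong λ i → not-∧-not (f i) (g i))

  cutWeight-submodular : ∀ A B →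
    cutWeight G (A ∩ B) + cutWeight G (A ∪ B) ≤ cutWeight G A + cutWeight G B
  cutWeight-submodular A B = subst₂ (λ a b → a + b ≤ cutWeight G A + cutWeight G B)
    (cutWeightᶠ-cong λ i → sym (lookup-zipWith _∧_ i A B))
    (cutWeightᶠ-cong λ i → sym (lookup-zipWith _∨_ i A B))
    (cutWeightᶠ-submodular (lookup A) (lookup B))

  cutWeight-posimodular : ∀ A B →
    cutWeight G (A ∩ ∁ B) + cutWeight G (B ∩ ∁ A) ≤ cutWeight G A + cutWeight G B
  cutWeight-posimodular A B = subst₂ (λ a b → a + b ≤ cutWeight G A + cutWeight G B)
    (cutWeightᶠ-cong λ i → sym (lookup-∩∁ A B i))
    (cutWeightᶠ-cong λ i → sym (lookup-∩∁ B A i))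
    (cutWeightᶠ-posimodular (lookup A) (lookup B))
    where
    lookup-∩∁ : ∀ P Q i → lookup (P ∩ ∁ Q) i ≡ lookup P i ∧ not (lookup Q i)
    lookup-∩∁ P Q i =
      trans (lookup-zipWith _∧_ i P (∁ Q)) (cong (lookup P i ∧_) (lookup-map i not Q))

module _ {n} (G : WGraph n) {r : Fin n} where

  mincut-uncross : ∀ {A B C D} → IsMincut G r A → IsMincut G r B → IsCut r C → IsCut r D →
    cutWeight G C + cutWeight G D ≤ cutWeight G A + cutWeight G B → IsMincut G r C
  mincut-uncross {A} {D = D} (_ , A-min) (_ , B-min) C-cut D-cut C+D≤A+B = C-cut , λ Z Z-cut →
    ≤-trans (+-cancelʳ-≤ (cutWeight G D)
              (≤-trans C+D≤A+B (+-monoʳ-≤ (cutWeight G A) (B-min D D-cut))))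
            (A-min Z Z-cut)

  ∩-cut : ∀ {A B x} → r ∉ A → x ∈ A ∩ B → IsCut r (A ∩ B)
  ∩-cut {A} {B} r∉A x∈A∩B = (_ , x∈A∩B) , λ r∈A∩B → r∉A (p∩q⊆p A B r∈A∩B)

  mincut-∩ : ∀ {A B x} → IsMincut G r A → IsMincut G r B → x ∈ A ∩ B → IsMincut G r (A ∩ B)
  mincut-∩ {A} {B} A-min@((_ , r∉A) , _) B-min@((_ , r∉B) , _) x∈A∩B =
    mincut-uncross A-min B-min (∩-cut r∉A x∈A∩B) ∪-cut (cutWeight-submodular G A B)
    where
    ∪-cut : IsCut r (A ∪ B)
    ∪-cut = (_ , x∈p∪q⁺ (inj₁ (p∩q⊆p A B x∈A∩B))) , [ r∉A , r∉B ] ∘ x∈p∪q⁻ A B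

  mincut-∩∁ : ∀ {A B x y} → IsMincut G r A → IsMincut G r B →
              x ∈ A ∩ ∁ B → y ∈ B ∩ ∁ A → IsMincut G r (A ∩ ∁ B)
  mincut-∩∁ {A} {B} A-min@((_ , r∉A) , _) B-min@((_ , r∉B) , _) x∈A∖B y∈B∖A =
    mincut-uncross A-min B-min (∩-cut r∉A x∈A∖B) (∩-cut r∉B y∈B∖A) (cutWeight-posimodular G A B)

p⊆q∧∣q∣≤∣p∣⇒q⊆p : ∀ {n} {p q : Subset n} → p ⊆ q → ∣ q ∣ ℕ.≤ ∣ p ∣ → q ⊆ p
p⊆q∧∣q∣≤∣p∣⇒q⊆p {p = p} p⊆q ∣q∣≤∣p∣ {x} x∈q with x ∈? p
... | yes x∈p = x∈p
... | no  x∉p = ⊥-elim (<⇒≱ (p⊂q⇒∣p∣<∣q∣ (p⊆q , x , x∈q , x∉p)) ∣q∣≤∣p∣)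

∈-tabulate⇔ : ∀ {n ℓ} {P : Pred (Fin n) ℓ} (P? : Decidable P) {x} →
              x ∈ tabulate (isYes ∘ P?) ⇔ P x
∈-tabulate⇔ P? {x} = mk⇔
  (λ x∈ → toWitness (T-≡ .from (trans (sym lookup-x) ([]=⇒lookup x∈))))
  (λ Px → lookup⇒[]= x _ (trans lookup-x (T-≡ .to (fromWitness Px))))
  where
  open Equivalence using (to; from)
  lookup-x : lookup (tabulate (isYes ∘ P?)) x ≡ isYes (P? x)
  lookup-x = lookup∘tabulate (isYes ∘ P?) x

∃-argmin : ∀ {n ℓ} {P : Pred (Fin n) ℓ} → Decidable P → (f : Fin n → ℕ) → ∀ {a} → P a →
           ∃ λ b → P b × (∀ c → P c → f b ℕ.≤ f c)
∃-argmin {P = P} P? f {a} Pa = go a (<-wellFounded (f a)) Pa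
  where
  go : ∀ a → Acc ℕ._<_ (f a) → P a → ∃ λ b → P b × (∀ c → P c → f b ℕ.≤ f c)
  go a (acc smaller) Pa with any? (λ c → P? c ×-dec f c <? f a)
  ... | yes (c , Pc , fc<fa) = go c (smaller fc<fa) Pc
  ... | no  ¬smaller         = a , Pa , λ c Pc → ≮⇒≥ λ fc<fa → ¬smaller (c , Pc , fc<fa)

module MinimalMincutTree {n} {G : WGraph n} {r : Fin n} (M : MinimalMincuts G r) where

  open MinimalMincuts M using () renaming (Xm to X)

  X-mincut : ∀ {v} → v ≢ r → IsMincut G r (X v)
  X-mincut v≢r = proj₁ (Xm-min M _ v≢r)

  X-minimal : ∀ {v Y} → v ≢ r → IsMincut G r Y → v ∈ Y → ∣ X v ∣ ℕ.≤ ∣ Y ∣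
  X-minimal v≢r = proj₂ (proj₂ (Xm-min M _ v≢r)) _

  ∈-X-root : ∀ {x} → x ∈ X r
  ∈-X-root {x} rewrite Xm-root M = ∈⊤

  ∈-X : ∀ v → v ∈ X v
  ∈-X v with v ≟ r
  ... | yes refl = ∈-X-root
  ... | no  v≢r  = proj₁ (proj₂ (Xm-min M v v≢r))

  X⊆mincut : ∀ {v Y} → IsMincut G r Y → v ∈ Y → X v ⊆ Y
  X⊆mincut {v} {Y} Y-min@((_ , r∉Y) , _) v∈Y =
    ⊆-trans (p⊆q∧∣q∣≤∣p∣⇒q⊆p (p∩q⊆p (X v) Y) ∣Xv∣≤∣Xv∩Y∣) (p∩q⊆q (X v) Y)
    where
    v≢r : v ≢ r
    v≢r refl = r∉Y v∈Y
    v∈Xv∩Y : v ∈ X v ∩ Y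
    v∈Xv∩Y = x∈p∩q⁺ (∈-X v , v∈Y)
    ∣Xv∣≤∣Xv∩Y∣ : ∣ X v ∣ ℕ.≤ ∣ X v ∩ Y ∣
    ∣Xv∣≤∣Xv∩Y∣ = X-minimal v≢r (mincut-∩ G (X-mincut v≢r) Y-min v∈Xv∩Y) v∈Xv∩Y

  mincut⊆X : ∀ {v Y z} → IsMincut G r Y → v ∉ Y → z ∈ X v → z ∈ Y → Y ⊆ X v
  mincut⊆X {v} {Y} {z} Y-min v∉Y z∈Xv z∈Y {y} y∈Y with v ≟ r | y ∈? X v
  ... | yes refl | _        = ∈-X-root
  ... | no  _    | yes y∈Xv = y∈Xv
  ... | no  v≢r  | no  y∉Xv = ⊥-elim (<⇒≱ ∣Xv∖Y∣<∣Xv∣ ∣Xv∣≤∣Xv∖Y∣)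
    where
    v∈Xv∖Y : v ∈ X v ∩ ∁ Y
    v∈Xv∖Y = x∈p∩q⁺ (∈-X v , x∉p⇒x∈∁p v∉Y)
    ∣Xv∣≤∣Xv∖Y∣ : ∣ X v ∣ ℕ.≤ ∣ X v ∩ ∁ Y ∣
    ∣Xv∣≤∣Xv∖Y∣ = X-minimal v≢r
      (mincut-∩∁ G (X-mincut v≢r) Y-min v∈Xv∖Y (x∈p∩q⁺ (y∈Y , x∉p⇒x∈∁p y∉Xv))) v∈Xv∖Y
    ∣Xv∖Y∣<∣Xv∣ : ∣ X v ∩ ∁ Y ∣ ℕ.< ∣ X v ∣
    ∣Xv∖Y∣<∣Xv∣ = p⊂q⇒∣p∣<∣q∣
      (p∩q⊆p (X v) (∁ Y) , z , z∈Xv , λ z∈Xv∖Y → x∈∁p⇒x∉p (p∩q⊆q (X v) (∁ Y) z∈Xv∖Y) z∈Y)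

  X-laminar : ∀ {a b z} → z ∈ X a → z ∈ X b → X a ⊆ X b ⊎ X b ⊂ X a
  X-laminar {a} {b} z∈Xa z∈Xb with b ≟ r | a ∈? X b
  ... | yes refl | _        = inj₁ λ _ → ∈-X-root
  ... | no  b≢r  | yes a∈Xb = inj₁ (X⊆mincut (X-mincut b≢r) a∈Xb)
  ... | no  b≢r  | no  a∉Xb =
    inj₂ (mincut⊆X (X-mincut b≢r) a∉Xb z∈Xa z∈Xb , a , ∈-X a , a∉Xb)

  LeastAbove : Subset n → Fin n → Set
  LeastAbove Y p = Y ⊂ X p × (∀ q → Y ⊂ X q → ∣ X p ∣ ℕ.≤ ∣ X q ∣)

  MaximalIn : Subset n → Fin n → Set
  MaximalIn Y u = X u ⊆ Y × ¬ (∃ λ q → X u ⊂ X q × X q ⊆ Y)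

  maximalIn? : ∀ Y → Decidable (MaximalIn Y)
  maximalIn? Y u = X u ⊆? Y ×-dec ¬? (any? λ q → X u ⊂? X q ×-dec X q ⊆? Y)

  leastAbove-exists : ∀ {Y} → r ∉ Y → ∃ (LeastAbove Y)
  leastAbove-exists {Y} r∉Y =
    ∃-argmin (λ q → Y ⊂? X q) (∣_∣ ∘ X) ((λ _ → ∈-X-root) , r , ∈-X-root , r∉Y)

  maximalIn-parent : ∀ {Y p u} →
    IsMincut G r Y → LeastAbove Y p → MaximalIn Y u → IsParent M p u
  maximalIn-parent {Y} {p} {u} Y-min@((_ , r∉Y) , _) (Y⊂Xp , p-least) (Xu⊆Y , u-maximal) =
    u≢r , ⊆-⊂-trans Xu⊆Y Y⊂Xp , nothing-between
    where
    u≢r : u ≢ r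
    u≢r refl = r∉Y (Xu⊆Y (∈-X u))
    nothing-between : ¬ ∃ λ q → X u ⊂ X q × X q ⊂ X p
    nothing-between (q , Xu⊂Xq , Xq⊂Xp) with q ∈? Y
    ... | yes q∈Y = u-maximal (q , Xu⊂Xq , X⊆mincut Y-min q∈Y)
    ... | no  q∉Y = <⇒≱ (p⊂q⇒∣p∣<∣q∣ Xq⊂Xp) (p-least q (Y⊆Xq , q , ∈-X q , q∉Y))
      where
      Y⊆Xq : Y ⊆ X q
      Y⊆Xq = mincut⊆X Y-min q∉Y (proj₁ Xu⊂Xq (∈-X u)) (Xu⊆Y (∈-X u))

  parent-exists : ∀ {v} → v ≢ r → ∃ λ p → IsParent M p v
  parent-exists {v} v≢r =
    let (p , p-least) = leastAbove-exists (proj₂ (proj₁ (X-mincut v≢r)))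
    in  p , maximalIn-parent (X-mincut v≢r) p-least (⊆-refl , v-maximal)
    where
    v-maximal : ¬ (∃ λ q → X v ⊂ X q × X q ⊆ X v)
    v-maximal (q , (_ , x , x∈Xq , x∉Xv) , Xq⊆Xv) = x∉Xv (Xq⊆Xv x∈Xq)

  parent-⊆ : ∀ {p v u} → IsParent M p v → X v ⊂ X u → X p ⊆ X u
  parent-⊆ {v = v} (_ , Xv⊂Xp , nothing-between) Xv⊂Xu
    with X-laminar (proj₁ Xv⊂Xp (∈-X v)) (proj₁ Xv⊂Xu (∈-X v))
  ... | inj₁ Xp⊆Xu = Xp⊆Xu
  ... | inj₂ Xu⊂Xp = ⊥-elim (nothing-between (_ , Xv⊂Xu , Xu⊂Xp))

  subtree-⊆ : ∀ {u x} → InSubtree M u x → X x ⊆ X u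
  subtree-⊆ ε                       = λ x∈ → x∈
  subtree-⊆ ((_ , Xv⊂Xu , _) ◅ path) = ⊆-trans (subtree-⊆ path) (p⊂q⇒p⊆q Xv⊂Xu)

  maximalIn-ancestor : ∀ {Y x} → r ∉ Y → X x ⊆ Y → ∃ λ u → MaximalIn Y u × InSubtree M u x
  maximalIn-ancestor {Y} {x} r∉Y = climb x (<-wellFounded (n ∸ ∣ X x ∣))
    where
    climb : ∀ x → Acc ℕ._<_ (n ∸ ∣ X x ∣) → X x ⊆ Y →
            ∃ λ u → MaximalIn Y u × InSubtree M u x
    climb x (acc smaller) Xx⊆Y with any? (λ q → X x ⊂? X q ×-dec X q ⊆? Y)
    ... | no  x-maximal           = x , (Xx⊆Y , x-maximal) , ε
    ... | yes (q , Xx⊂Xq , Xq⊆Y) =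
      let (u , u-maximal , u↝p) =
            climb p (smaller ∣X∣-grows) (⊆-trans (parent-⊆ p↝x Xx⊂Xq) Xq⊆Y)
      in  u , u-maximal , u↝p ◅◅ (p↝x ◅ ε)
      where
      x≢r : x ≢ r
      x≢r refl = r∉Y (Xx⊆Y (∈-X x))
      p : Fin n
      p = proj₁ (parent-exists x≢r)
      p↝x : IsParent M p x
      p↝x = proj₂ (parent-exists x≢r)
      ∣X∣-grows : n ∸ ∣ X p ∣ ℕ.< n ∸ ∣ X x ∣
      ∣X∣-grows = ∸-monoʳ-< (p⊂q⇒∣p∣<∣q∣ (proj₁ (proj₂ p↝x))) (∣p∣≤n (X p))

lemmaA3 : ∀ {n} (G : WGraph n) (r : Fin n) (M : MinimalMincuts G r)
          (X : Subset n) → IsMincut G r X →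
          Σ (Subset n) λ S →
            (∃ λ p → ∀ u → u ∈ S → IsParent M p u)
            × (∀ x → x ∈ X ⇔ (∃ λ u → u ∈ S × InSubtree M u x))
lemmaA3 {n} G r M X X-min@((_ , r∉X) , _) =
  S , (p , λ u u∈S → maximalIn-parent X-min p-least (∈S⇔ .to u∈S))
    , λ x → mk⇔ ancestor-in-S inside
  where
  open MinimalMincutTree M
    using ( LeastAbove; MaximalIn; maximalIn?; leastAbove-exists; maximalIn-parent
          ; maximalIn-ancestor; X⊆mincut; subtree-⊆; ∈-X)
  open Equivalence using (to; from)
  S : Subset n
  S = tabulate (isYes ∘ maximalIn? X)
  ∈S⇔ : ∀ {u} → u ∈ S ⇔ MaximalIn X u
  ∈S⇔ = ∈-tabulate⇔ (maximalIn? X)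
  p : Fin n
  p = proj₁ (leastAbove-exists r∉X)
  p-least : LeastAbove X p
  p-least = proj₂ (leastAbove-exists r∉X)
  ancestor-in-S : ∀ {x} → x ∈ X → ∃ λ u → u ∈ S × InSubtree M u x
  ancestor-in-S x∈X =
    let (u , u-maximal , u↝x) = maximalIn-ancestor r∉X (X⊆mincut X-min x∈X)
    in  u , ∈S⇔ .from u-maximal , u↝x
  inside : ∀ {x} → (∃ λ u → u ∈ S × InSubtree M u x) → x ∈ X
  inside {x} (u , u∈S , u↝x) = proj₁ (∈S⇔ .to u∈S) (subtree-⊆ u↝x (∈-X x))
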